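{- Let $T$ be a tournament and $R\subseteq V(T)$. If the directed domination graph $\vec{D}(T[R])$ contains a directed cycle $C$ with $R\setminus V(C)\neq\emptyset$, then $R$ is not a minimal $\tau$-retentive set of $T$.
   Context: A tournament $T$ consists of a finite vertex set $V(T)$ and an asymmetric, complete binary relation $\succ$ on $V(T)$ ($x$ dominates $y$ if $x\succ y$). For $v\in V(T)$ let $N^-_T(v)=\{u: u\succ v\}$; for $B\subseteq V(T)$, $T[B]$ is the induced subtournament. In a tournament $S$, $u$ is the captain of $v$ if $u\succ v$ and $u\succ w$ for every $w\in N^-_S(v)\setminus\{u\}$. The directed domination graph $\vec{D}(S)$ has vertex set $V(S)$ and an arc from $u$ to $v$ iff $u$ is the captain of $v$ in $S$. A directed cycle is a sequence of distinct vertices $(v_0,\dots,v_{k-1})$ with an arc from $v_i$ to $v_{(i+1)\bmod k}$ for all $i$; $V(C)$ is its vertex set. The tournament equilibrium set $\tau$ is defined recursively: a nonempty $A\subseteq V(T)$ is $\tau$-retentive if for every $x\in A$ with $N^-_T(x)\neq\emptyset$, $\tau(T[N^-_T(x)])\subseteq A$; $A$ is a minimal $\tau$-retentive set if no $\tau$-retentive set of $T$ is a proper subset of $A$; $\tau(T)$ is the union of all minimal $\tau$-retentive sets of $T$. -}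

module Defs where

open import Data.Nat using (ℕ; zero; suc)
open import Data.Nat.DivMod using (_mod_)
open import Data.Fin using (Fin; toℕ)
open import Data.Fin.Subset using (Subset; _∈_; _∉_; _⊆_; _⊂_; Nonempty; ⊤)
open import Data.Vec using (tabulate)
open import Data.Bool using (_∧_)
open import Data.Product using (_×_; ∃; Σ)
open import Data.Empty using (⊥)
import Data.Sum
import Data.Vec
open import Relation.Nullary using (Dec; ¬_)
open import Relation.Nullary.Decidable using (isYes)
open import Relation.Binary.PropositionalEquality using (_≡_; _≢_)
open import Function.Definitions using (Injective)

-- A tournament on the finite vertex set Fin n: an asymmetric, complete
-- (on distinct vertices) binary relation; decidability is recorded so that
-- in-neighbourhoods can be computed as subsets.
record Tournament (n : ℕ) : Set₁ where
  field
    _≻_      : Fin n → Fin n → Set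
    ≻-dec    : (x y : Fin n) → Dec (x ≻ y)
    asym     : ∀ {x y} → x ≻ y → ¬ (y ≻ x)
    complete : ∀ {x y} → x ≢ y → (x ≻ y) Data.Sum.⊎ (y ≻ x)
open Tournament public

inN : ∀ {n} → Tournament n → Subset n → Fin n → Subset n
inN T B x = tabulate λ u → isYes (≻-dec T u x) ∧ Data.Vec.lookup B u

-- τ of the induced subtournament T[B], computed with recursion fuel k.
-- It is correct whenever k ≥ ∣B∣ (in-neighbourhoods shrink strictly).
mutual
  RetentiveF : ∀ {n} → Tournament n → ℕ → Subset n → Subset n → Set
  RetentiveF T k B A =
    Nonempty A × A ⊆ B ×
    (∀ x → x ∈ A → Nonempty (inN T B x) →
       ∀ y → tauF T k (inN T B x) y → y ∈ A)

  MinRetentiveF : ∀ {n} → Tournament n → ℕ → Subset n → Subset n → Set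
  MinRetentiveF T k B A =
    RetentiveF T k B A × (∀ A' → ¬ (RetentiveF T k B A' × A' ⊂ A))

  tauF : ∀ {n} → Tournament n → ℕ → Subset n → Fin n → Set
  tauF T zero    B v = ⊥
  tauF T (suc k) B v = ∃ λ A → MinRetentiveF T k B A × v ∈ A

-- τ-retentive / minimal τ-retentive sets of T itself (B = V(T), fuel n ≥ ∣N⁻(x)∣)
Retentive : ∀ {n} → Tournament n → Subset n → Set
Retentive {n} T A = RetentiveF T n ⊤ A

MinimalRetentive : ∀ {n} → Tournament n → Subset n → Set
MinimalRetentive {n} T A = MinRetentiveF T n ⊤ A

Captain : ∀ {n} → Tournament n → Subset n → Fin n → Fin n → Set
Captain T R u v =
  u ∈ R × v ∈ R × _≻_ T u v ×
  (∀ w → w ∈ R → _≻_ T w v → w ≢ u → _≻_ T u w)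

record DomCycle {n} (T : Tournament n) (R : Subset n) : Set where
  field
    len   : ℕ
    verts : Fin (suc len) → Fin n
    inj   : Injective _≡_ _≡_ verts
    arcs  : ∀ i → Captain T R (verts i) (verts ((suc (toℕ i)) mod (suc len)))

OnCycle : ∀ {n} {T : Tournament n} {R : Subset n} → DomCycle T R → Fin n → Set
OnCycle C v = ∃ λ i → DomCycle.verts C i ≡ v

-- For x on C let u be its predecessor on C, the captain of x in T[R].  As R is
-- retentive, τ(N⁻(x)) ⊆ R, and within N⁻(x) the vertex u beats every other vertex
-- of R.  Such a vertex is all of τ(N⁻(x)): by induction on size, a minimal
-- retentive set A ⊆ R of N⁻(x) containing some y ≠ u also contains u (since
-- u ∈ N⁻(y) and τ(N⁻(y)) = {u} ⊆ A), so u has no in-neighbour in N⁻(x) and {u}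
-- would be a smaller retentive set.  Hence V(C) is retentive, and it is a proper
-- subset of R.
module Submission where

open import Defs hiding (_≻_; ≻-dec; asym; complete)
open import Data.Nat using (ℕ; suc; _<_; _%_; s≤s)
open import Data.Nat.Properties using (<-≤-trans; ≤-pred; m<n⇒0<n)
open import Data.Nat.DivMod using (_mod_; n%n≡0; m<n⇒m%n≡m)
open import Data.Fin using (Fin; toℕ; fromℕ; inject₁; _≟_) renaming (zero to fzero; suc to fsuc)
open import Data.Fin.Properties using (toℕ-injective; toℕ-fromℕ; toℕ-inject₁; toℕ<n; toℕ-fromℕ<; any?)
open import Data.Fin.Subset using (Subset; _∈_; _⊆_; _⊂_; Nonempty; ⊤; ⁅_⁆; ∣_∣)
open import Data.Fin.Subset.Properties using (p⊂q⇒∣p∣<∣q∣; ∣p∣≤n; ∈⊤; x∈⁅x⁆; x∈⁅y⁆⇒x≡y)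
open import Data.Fin.Subset.Induction using (⊂-wellFounded)
open import Data.Vec using (tabulate; lookup)
open import Data.Vec.Properties using (lookup∘tabulate; []=⇒lookup; lookup⇒[]=)
open import Data.Bool using (Bool; T)
open import Data.Bool.Properties using (T-≡; T-∧)
open import Data.Empty using (⊥-elim)
open import Data.Product using (∃; _×_; _,_)
open import Function using (_∘_)
open import Function.Bundles using (_⇔_; mk⇔; Equivalence)
open import Induction.WellFounded using (Acc; acc)
open import Relation.Nullary using (¬_; yes; no)
open import Relation.Nullary.Decidable using (isYes; toWitness; fromWitness; ¬¬-excluded-middle)
open import Relation.Binary.PropositionalEquality using (_≡_; _≢_; refl; sym; subst; cong; module ≡-Reasoning)

open Equivalence using (to; from)

∈⇔T-lookup : ∀ {n} {p : Subset n} {x} → x ∈ p ⇔ T (lookup p x)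
∈⇔T-lookup {p = p} {x} =
  mk⇔ (λ x∈p → from T-≡ ([]=⇒lookup x∈p)) (λ t → lookup⇒[]= x p (to T-≡ t))

∈-tabulate⇔ : ∀ {n} {f : Fin n → Bool} {x} → x ∈ tabulate f ⇔ T (f x)
∈-tabulate⇔ {f = f} {x} = subst (λ b → x ∈ tabulate f ⇔ T b) (lookup∘tabulate f x) ∈⇔T-lookup

⁅⁆⊂ : ∀ {n} {A : Subset n} {u y} → u ∈ A → y ∈ A → y ≢ u → ⁅ u ⁆ ⊂ A
⁅⁆⊂ {u = u} u∈A y∈A y≢u =
  (λ x∈⁅u⁆ → subst (_∈ _) (sym (x∈⁅y⁆⇒x≡y u x∈⁅u⁆)) u∈A) ,
  _ , y∈A , λ y∈⁅u⁆ → y≢u (x∈⁅y⁆⇒x≡y u y∈⁅u⁆)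

module _ {len : ℕ} where

  next : Fin (suc len) → Fin (suc len)
  next i = suc (toℕ i) mod suc len

  next-surjective : ∀ i → ∃ λ j → next j ≡ i
  next-surjective fzero = fromℕ len , toℕ-injective (begin
    toℕ (next (fromℕ len))          ≡⟨ toℕ-fromℕ< _ ⟩
    suc (toℕ (fromℕ len)) % suc len ≡⟨ cong (λ m → suc m % suc len) (toℕ-fromℕ len) ⟩
    suc len % suc len               ≡⟨ n%n≡0 (suc len) ⟩
    0                               ∎)
    where open ≡-Reasoning
  next-surjective (fsuc i) = inject₁ i , toℕ-injective (begin
    toℕ (next (inject₁ i))          ≡⟨ toℕ-fromℕ< _ ⟩
    suc (toℕ (inject₁ i)) % suc len ≡⟨ cong (λ m → suc m % suc len) (toℕ-inject₁ i) ⟩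
    suc (toℕ i) % suc len           ≡⟨ m<n⇒m%n≡m (s≤s (toℕ<n i)) ⟩
    suc (toℕ i)                     ∎)
    where open ≡-Reasoning

module _ {n} (T : Tournament n) where
  open Tournament T using (_≻_; asym)

  ≻⇒≢ : ∀ {x y} → x ≻ y → x ≢ y
  ≻⇒≢ x≻y refl = asym x≻y x≻y

  ∈-inN⇔ : ∀ {B x u} → u ∈ inN T B x ⇔ (u ≻ x × u ∈ B)
  ∈-inN⇔ = mk⇔
    (λ u∈N → let t , b = to T-∧ (to ∈-tabulate⇔ u∈N) in toWitness t , from ∈⇔T-lookup b)
    (λ (u≻x , u∈B) → from ∈-tabulate⇔ (from T-∧ (fromWitness u≻x , to ∈⇔T-lookup u∈B)))

  inN⊂ : ∀ {B x} → x ∈ B → inN T B x ⊂ B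
  inN⊂ {B} {x} x∈B =
    (λ u∈N → let _ , u∈B = to (∈-inN⇔ {B} {x}) u∈N in u∈B) ,
    x , x∈B , λ x∈N → let x≻x , _ = to (∈-inN⇔ {B} {x}) x∈N in ≻⇒≢ x≻x refl

  ∣inN∣< : ∀ {k B x} → x ∈ B → ∣ B ∣ < suc k → ∣ inN T B x ∣ < k
  ∣inN∣< x∈B ∣B∣<1+k = <-≤-trans (p⊂q⇒∣p∣<∣q∣ (inN⊂ x∈B)) (≤-pred ∣B∣<1+k)

  tauF-⊆ : ∀ {k B y} → tauF T k B y → y ∈ B
  tauF-⊆ {suc k} (_ , ((_ , A⊆B , _) , _) , y∈A) = A⊆B y∈A

  whole-retentive : ∀ {k B} → Nonempty B → RetentiveF T k B B
  whole-retentive {B = B} ne =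
    ne , (λ x∈B → x∈B) ,
    λ x _ _ _ y∈τ → let _ , y∈B = to (∈-inN⇔ {B} {x}) (tauF-⊆ y∈τ) in y∈B

  source-retentive : ∀ {k B u} → u ∈ B → ¬ Nonempty (inN T B u) → RetentiveF T k B ⁅ u ⁆
  source-retentive {B = B} {u} u∈B no-in =
    (u , x∈⁅x⁆ u) ,
    (λ x∈⁅u⁆ → subst (_∈ B) (sym (x∈⁅y⁆⇒x≡y u x∈⁅u⁆)) u∈B) ,
    λ _ x∈⁅u⁆ ne → ⊥-elim (no-in (subst (λ v → Nonempty (inN T B v)) (x∈⁅y⁆⇒x≡y u x∈⁅u⁆) ne))

  retentive⇒¬¬minimal : ∀ {k B A} → RetentiveF T k B A → ¬ ¬ ∃ (MinRetentiveF T k B)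
  retentive⇒¬¬minimal {k} {B} retA = descend retA (⊂-wellFounded _)
    where
    descend : ∀ {A} → RetentiveF T k B A → Acc _⊂_ A → ¬ ¬ ∃ (MinRetentiveF T k B)
    descend {A} retA (acc below) no-min =
      ¬¬-excluded-middle {A = ∃ λ A' → RetentiveF T k B A' × A' ⊂ A} λ
      { (yes (A' , retA' , A'⊂A)) → descend retA' (below A'⊂A) no-min
      ; (no none-below)           → no-min (A , retA , λ A' p → none-below (A' , p))
      }

  tauF-nonempty : ∀ {k B} → 0 < k → Nonempty B → ¬ ¬ ∃ (tauF T k B)
  tauF-nonempty {suc k} _ ne no-τ = retentive⇒¬¬minimal (whole-retentive ne)
    λ (A , minA@(((x , x∈A) , _) , _)) → no-τ (x , A , minA , x∈A)

  Dominates : Subset n → Subset n → Fin n → Set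
  Dominates S R u = ∀ w → w ∈ S → w ∈ R → w ≢ u → u ≻ w

  dominator-has-no-in-neighbour : ∀ {k S R A u} → ∣ S ∣ < suc k → RetentiveF T k S A → A ⊆ R →
    u ∈ A → Dominates S R u → ¬ Nonempty (inN T S u)
  dominator-has-no-in-neighbour {S = S} {u = u} ∣S∣<1+k (_ , A⊆S , retA) A⊆R u∈A dom ne =
    tauF-nonempty (m<n⇒0<n (∣inN∣< (A⊆S u∈A) ∣S∣<1+k)) ne λ (z , z∈τ) →
      let z≻u , z∈S = to (∈-inN⇔ {S} {u}) (tauF-⊆ z∈τ)
      in asym z≻u (dom z z∈S (A⊆R (retA u u∈A ne z z∈τ)) (≻⇒≢ z≻u))

  tauF-⊆-dominator : ∀ {k S R u} → ∣ S ∣ < k → (∀ y → tauF T k S y → y ∈ R) →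
    u ∈ S → u ∈ R → Dominates S R u → ∀ y → tauF T k S y → y ≡ u
  tauF-⊆-dominator {suc k} {S} {R} {u} ∣S∣<1+k τ⊆R u∈S u∈R dom y
    (A , minA@(retA@(_ , A⊆S , closedA) , A-minimal) , y∈A) with y ≟ u
  ... | yes y≡u = y≡u
  ... | no y≢u = ⊥-elim (¬¬u∈A λ u∈A →
    A-minimal ⁅ u ⁆
      ( source-retentive u∈S (dominator-has-no-in-neighbour ∣S∣<1+k retA A⊆R u∈A dom)
      , ⁅⁆⊂ u∈A y∈A y≢u ))
    where
    A⊆R : A ⊆ R
    A⊆R {a} a∈A = τ⊆R a (A , minA , a∈A)

    u∈N⁻y : u ∈ inN T S y
    u∈N⁻y = from ∈-inN⇔ (dom y (A⊆S y∈A) (A⊆R y∈A) y≢u , u∈S)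

    ∣N⁻y∣<k : ∣ inN T S y ∣ < k
    ∣N⁻y∣<k = ∣inN∣< (A⊆S y∈A) ∣S∣<1+k

    τN⁻y⊆A : ∀ z → tauF T k (inN T S y) z → z ∈ A
    τN⁻y⊆A = closedA y y∈A (u , u∈N⁻y)

    τN⁻y≡u : ∀ z → tauF T k (inN T S y) z → z ≡ u
    τN⁻y≡u = tauF-⊆-dominator ∣N⁻y∣<k (λ z z∈τ → A⊆R (τN⁻y⊆A z z∈τ)) u∈N⁻y u∈R
      λ w w∈N⁻y → let _ , w∈S = to (∈-inN⇔ {S} {y}) w∈N⁻y in dom w w∈S

    ¬¬u∈A : ¬ ¬ u ∈ A
    ¬¬u∈A u∉A = tauF-nonempty (m<n⇒0<n ∣N⁻y∣<k) (u , u∈N⁻y) λ (z , z∈τ) →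
      u∉A (subst (_∈ A) (τN⁻y≡u z z∈τ) (τN⁻y⊆A z z∈τ))

  captain-dominates : ∀ {B R u x} → Captain T R u x → Dominates (inN T B x) R u
  captain-dominates {B} {x = x} (_ , _ , _ , beats) w w∈N⁻x w∈R =
    let w≻x , _ = to (∈-inN⇔ {B} {x}) w∈N⁻x in beats w w∈R w≻x

module _ {n} {T : Tournament n} {R : Subset n} (C : DomCycle T R) where
  open DomCycle C

  cycleVertices : Subset n
  cycleVertices = tabulate λ w → isYes (any? λ i → verts i ≟ w)

  ∈-cycleVertices⇔ : ∀ {w} → w ∈ cycleVertices ⇔ OnCycle C w
  ∈-cycleVertices⇔ = mk⇔ (toWitness ∘ to ∈-tabulate⇔) (from ∈-tabulate⇔ ∘ fromWitness)

  onCycle⇒∈ : ∀ {x} → OnCycle C x → x ∈ R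
  onCycle⇒∈ (i , refl) = let verts-i∈R , _ = arcs i in verts-i∈R

  captain-on-cycle : ∀ {x} → OnCycle C x → ∃ λ u → OnCycle C u × Captain T R u x
  captain-on-cycle (i , refl) =
    let j , next-j≡i = next-surjective i
    in verts j , (j , refl) , subst (λ k → Captain T R (verts j) (verts k)) next-j≡i (arcs j)

  cycleVertices-retentive : Retentive T R → Retentive T cycleVertices
  cycleVertices-retentive (_ , _ , closedR) =
    (verts fzero , from ∈-cycleVertices⇔ (fzero , refl)) , (λ _ → ∈⊤) , closed
    where
    closed : ∀ x → x ∈ cycleVertices → Nonempty (inN T ⊤ x) →
             ∀ y → tauF T n (inN T ⊤ x) y → y ∈ cycleVertices
    closed x x∈C ne y y∈τ =
      let x∈R = onCycle⇒∈ (to ∈-cycleVertices⇔ x∈C)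
          u , u∈C , u-captain@(u∈R , _ , u≻x , _) = captain-on-cycle (to ∈-cycleVertices⇔ x∈C)
          ∣N⁻x∣<n = <-≤-trans (p⊂q⇒∣p∣<∣q∣ (inN⊂ T {⊤} {x} ∈⊤)) (∣p∣≤n ⊤)
          y≡u = tauF-⊆-dominator T ∣N⁻x∣<n (closedR x x∈R ne) (from (∈-inN⇔ T {⊤} {x}) (u≻x , ∈⊤)) u∈R
                  (captain-dominates T {⊤} u-captain) y y∈τ
      in from ∈-cycleVertices⇔ (subst (OnCycle C) (sym y≡u) u∈C)

lemma6 : ∀ {n} (T : Tournament n) (R : Subset n) (C : DomCycle T R) →
    (∃ λ v → v ∈ R × ¬ OnCycle C v) →
    ¬ MinimalRetentive T R
lemma6 T R C (v , v∈R , v∉C) (R-retentive , R-minimal) =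
  R-minimal (cycleVertices C) (cycleVertices-retentive C R-retentive , C⊂R)
  where
  C⊂R : cycleVertices C ⊂ R
  C⊂R = onCycle⇒∈ C ∘ to (∈-cycleVertices⇔ C) , v , v∈R , v∉C ∘ to (∈-cycleVertices⇔ C)
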